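{- Let $q$ be a prime power and $\vec{B}=(\vec{b}_1;\dots;\vec{b}_k)\in\mathbb{F}_q^{k\times n}$ a $\beta$-BKZ-reduced basis with $\beta-1$ dividing $k-1$. Let $\ell_1:=|\vec{b}_1|$, $w_1:=s_q(\ell_1,\beta)$, and for $i\ge1$ define \[c_i:=\left\lceil\frac{(q-1)w_i}{q^\beta-1}\right\rceil,\qquad w_{i+1}:=s_q(c_i,\beta).\] Then \[n\ge w_1-c_1+w_2-c_2+\dots+w_{(k-1)/(\beta-1)}.\]
   Context: $s_q(d,k)$ is the minimal $n$ such that there exists a linear code in $\mathbb{F}_q^n$ of dimension $k$ and minimum distance $d$. $|\vec{x}|$ is the Hamming weight. $\pi^\perp_{\{\vec{x}_1,\dots,\vec{x}_m\}}$ zeroes all coordinates in the union of supports; $\pi_i:=\pi^\perp_{\{\vec{b}_1,\dots,\vec{b}_{i-1}\}}$, $\vec{b}_i^+:=\pi_i(\vec{b}_i)$, $\vec{B}_{[i,j]}:=(\pi_i(\vec{b}_i);\dots;\pi_i(\vec{b}_j))$, with $\vec{B}_{[i,j]}:=\vec{B}_{[i,k]}$ for $j>k$. Forward reduced: the first vector is a shortest nonzero codeword of the generated code. $\beta$-BKZ reduced: $\vec{B}_{[i,i+\beta-1]}$ forward reduced for all $i\in[1,k]$. The sum alternates $w_i-c_i$ for $i<(k-1)/(\beta-1)$ and ends with $w_{(k-1)/(\beta-1)}$. -}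

module Defs where

open import Level using (Level; _⊔_)
open import Algebra.Bundles using (CommutativeRing)
open import Data.Nat using (ℕ; zero; suc; _∸_; _≤_; _<_; _/_)
import Data.Nat as ℕ
open import Data.Fin using (Fin; toℕ)
import Data.Fin as Fin
open import Data.Bool using (Bool; true; false; if_then_else_; not; _∨_)
open import Data.Product using (Σ; _×_; ∃)
open import Relation.Nullary using (¬_; does)
open import Relation.Binary using (Decidable)
open import Relation.Binary.PropositionalEquality using (_≡_)

IsField : ∀ {c ℓ} → CommutativeRing c ℓ → Set (c ⊔ ℓ)
IsField R = (¬ (1# ≈ 0#)) × (∀ x → ¬ (x ≈ 0#) → Σ Carrier λ y → (x * y) ≈ 1#)
  where open CommutativeRing R

-- Ceiling division on ℕ:  ⌈ a / b ⌉  (b = 0 never used; set to 0).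

⌈_/_⌉ : ℕ → ℕ → ℕ
⌈ a / zero ⌉  = 0
⌈ a / suc b ⌉ = (a ℕ.+ b) / suc b

-- Alternating sum  (w₁ - c₁) + … + (w_{m-1} - c_{m-1}) + w_m   (indices from 1);
-- for m = 0 this is the empty sum 0.

altPrefix : (ℕ → ℕ) → (ℕ → ℕ) → ℕ → ℕ
altPrefix w c zero    = 0
altPrefix w c (suc m) = altPrefix w c m ℕ.+ (w (suc m) ∸ c (suc m))

altSum : (ℕ → ℕ) → (ℕ → ℕ) → ℕ → ℕ
altSum w c zero    = 0
altSum w c (suc m) = altPrefix w c m ℕ.+ w (suc m)

module Coding {c ℓ} (R : CommutativeRing c ℓ) (_≟_ : Decidable (CommutativeRing._≈_ R)) where
  open CommutativeRing R

  Vect : ℕ → Set c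
  Vect n = Fin n → Carrier

  IsZeroVec : ∀ {n} → Vect n → Set ℓ
  IsZeroVec x = ∀ j → x j ≈ 0#

  nz : ∀ {n} → Vect n → Fin n → Bool
  nz x j = not (does (x j ≟ 0#))

  wt : ∀ {n} → Vect n → ℕ
  wt {zero}  x = 0
  wt {suc n} x = (if nz x Fin.zero then 1 else 0) ℕ.+ wt (λ j → x (Fin.suc j))

  linComb : ∀ {k n} → (Fin k → Carrier) → (Fin k → Vect n) → Vect n
  linComb {zero}  a v j = 0#
  linComb {suc k} a v j = (a Fin.zero * v Fin.zero j) + linComb (λ l → a (Fin.suc l)) (λ l → v (Fin.suc l)) j

  LinIndep : ∀ {k n} → (Fin k → Vect n) → Set (c ⊔ ℓ)
  LinIndep v = ∀ a → IsZeroVec (linComb a v) → ∀ l → a l ≈ 0#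

  HasCode : (n k d : ℕ) → Set (c ⊔ ℓ)
  HasCode n k d = Σ (Fin k → Vect n) λ G →
      LinIndep G
    × (Σ (Fin k → Carrier) λ a → (¬ IsZeroVec (linComb a G)) × wt (linComb a G) ≡ d)
    × (∀ a → ¬ IsZeroVec (linComb a G) → d ≤ wt (linComb a G))

  IsS : (d k s : ℕ) → Set (c ⊔ ℓ)
  IsS d k s = HasCode s k d × (∀ n → n < s → ¬ HasCode n k d)

  anyBelow : ∀ {k} → ℕ → (Fin k → Bool) → Bool
  anyBelow {zero}  i P = false
  anyBelow {suc k} zero    P = false
  anyBelow {suc k} (suc i) P = P Fin.zero ∨ anyBelow i (λ l → P (Fin.suc l))

  -- π_i (0-indexed: i = toℕ of the row index): zero every coordinate lying in the
  -- support of some b_l with l < i.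
  proj : ∀ {k n} → (Fin k → Vect n) → ℕ → Vect n → Vect n
  proj B i x j = if anyBelow i (λ l → nz (B l) j) then 0# else x j

  -- B_[i, i+β-1] (0-indexed, truncated at k) is forward reduced:
  -- π_i(b_i) is a shortest nonzero codeword of the code spanned by
  -- π_i(b_i), …, π_i(b_{min(i+β-1,k-1)}).
  ForwardReducedBlock : ∀ {k n} → (Fin k → Vect n) → (β : ℕ) → Fin k → Set (c ⊔ ℓ)
  ForwardReducedBlock B β i =
      (¬ IsZeroVec (proj B (toℕ i) (B i)))
    × (∀ a → (∀ l → ¬ (toℕ i ≤ toℕ l × toℕ l < toℕ i ℕ.+ β) → a l ≈ 0#)
           → ¬ IsZeroVec (linComb a (λ l → proj B (toℕ i) (B l)))
           → wt (proj B (toℕ i) (B i)) ≤ wt (linComb a (λ l → proj B (toℕ i) (B l))))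

  BKZReduced : ∀ {k n} → (β : ℕ) → (Fin k → Vect n) → Set (c ⊔ ℓ)
  BKZReduced β B = ∀ i → ForwardReducedBlock B β i

module Submission where

-- Write ℓ i = |π_i b_i| and let free j count the coordinates outside the supports of b_0, …, b_{j-1}.
-- For a block starting at row i, the projected rows π_i b_i, …, π_i b_{i+β-1} generate an [N, β, ℓ i] code
-- on the N ≤ free i coordinates they use; puncturing it to distance x gives s_q(x, β) + ℓ i ≤ N + x.
-- Of these N coordinates only those in the support of π_j b_j, j = i + β - 1, stay free after the block,
-- so N + free j ≤ free i + ℓ j.  Averaging the weights of the pencil α π_i b_i + π_i b_{i+1} over α ∈ F
-- gives ℓ i ≤ q ℓ (i+1), hence ℓ i ≤ q^(β-1) ℓ j; as r copies of the simplex code form an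
-- [r (q^β - 1)/(q - 1), β, r q^(β-1)] code, this forces c ≤ ℓ j.  Chaining the three inequalities from block
-- to block (the next block starts with x = c) telescopes into the alternating sum, and free 0 = n.

open import Defs
open import Level using (Level; _⊔_)
open import Algebra.Bundles using (CommutativeRing)
open import Relation.Binary using (Decidable; tri<; tri≈; tri>)
open import Relation.Binary.PropositionalEquality
  using (_≡_; _≢_; refl; sym; trans; cong; cong₂; subst; subst₂; setoid; module ≡-Reasoning)
import Relation.Binary.Reasoning.Setoid
open import Function using (_∘_)
open import Function.Bundles using (Bijection; Surjection)
open import Data.Nat using (ℕ; zero; suc; _+_; _*_; _∸_; _^_; _≤_; _<_; z≤n; s≤s; NonZero; >-nonZero)
import Data.Nat.Properties as ℕ
open import Data.Nat.Primality using (Prime)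
open import Data.Nat.DivMod using (m<n*o⇒m/o<n)
open import Data.Nat.Tactic.RingSolver using (solve-∀)
open import Algebra.Properties.CommutativeSemigroup ℕ.*-commutativeSemigroup using (x∙yz≈y∙xz)
open import Algebra.Properties.Semiring.Sum ℕ.+-*-semiring
  using (sum; ∑-comm; ∑-distrib-+; sum-remove; sum-cong-≗; *-distribˡ-sum; *-distribʳ-sum)
open import Data.Bool using (Bool; true; false; if_then_else_; not)
open import Data.Fin using (Fin; toℕ; punchIn)
import Data.Fin as Fin
import Data.Fin.Properties as Finₚ
open import Data.Fin.Induction using (>-wellFounded)
open import Induction.WellFounded using (Acc; acc)
import Data.Vec.Functional as V
open import Data.List using (List; []; _∷_; _++_; length; concat; replicate; map; tabulate; lookup)
open import Data.List.Properties using (length-++; length-map)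
open import Data.Product using (Σ; _×_; _,_; proj₁; proj₂)
open import Data.Sum using (inj₁; inj₂)
open import Data.Empty using (⊥-elim)
open import Relation.Nullary using (¬_; Dec; yes; no; does)

𝟙 : Bool → ℕ
𝟙 b = if b then 1 else 0

count : ∀ {n} → (Fin n → Bool) → ℕ
count f = sum (𝟙 ∘ f)

𝟙≤1 : ∀ b → 𝟙 b ≤ 1
𝟙≤1 true  = ℕ.≤-refl
𝟙≤1 false = z≤n

sum-mono-≤ : ∀ {n} {f g : Fin n → ℕ} → (∀ i → f i ≤ g i) → sum f ≤ sum g
sum-mono-≤ {zero}  f≤g = z≤n
sum-mono-≤ {suc n} f≤g = ℕ.+-mono-≤ (f≤g Fin.zero) (sum-mono-≤ (f≤g ∘ Fin.suc))

sum-const : ∀ n a → sum {n} (λ _ → a) ≡ n * a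
sum-const zero    a = refl
sum-const (suc n) a = cong (a +_) (sum-const n a)

count-true : ∀ n → count {n} (λ _ → true) ≡ n
count-true n = trans (sum-const n 1) (ℕ.*-identityʳ n)

count≤n : ∀ {n} (f : Fin n → Bool) → count f ≤ n
count≤n {n} f = subst (count f ≤_) (count-true n) (sum-mono-≤ (𝟙≤1 ∘ f))

count<n : ∀ {n} (f : Fin n → Bool) (p : Fin n) → f p ≡ false → count f < n
count<n {suc n} f p fp≡false = begin-strict
  count f                          ≡⟨ sum-remove {i = p} (𝟙 ∘ f) ⟩
  𝟙 (f p) + count (f ∘ punchIn p)  ≡⟨ cong (λ b → 𝟙 b + count (f ∘ punchIn p)) fp≡false ⟩
  count (f ∘ punchIn p)            <⟨ s≤s (count≤n (f ∘ punchIn p)) ⟩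
  suc n                            ∎
  where open ℕ.≤-Reasoning

count-false : ∀ {n} (f : Fin n → Bool) → (∀ i → f i ≡ false) → count f ≡ 0
count-false {zero}  f all-false = refl
count-false {suc n} f all-false rewrite all-false Fin.zero = count-false (f ∘ Fin.suc) (all-false ∘ Fin.suc)

count≢0⇒∃true : ∀ {n} (f : Fin n → Bool) → count f ≢ 0 → Σ (Fin n) (λ i → f i ≡ true)
count≢0⇒∃true {zero}  f count≢0 = ⊥-elim (count≢0 refl)
count≢0⇒∃true {suc n} f count≢0 with f Fin.zero in f0
... | true  = Fin.zero , f0
... | false with count≢0⇒∃true (f ∘ Fin.suc) count≢0
...   | i , fi = Fin.suc i , fi

true⇒1≤count : ∀ {n} (f : Fin n → Bool) (p : Fin n) → f p ≡ true → 1 ≤ count f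
true⇒1≤count {suc n} f Fin.zero    fp rewrite fp = s≤s z≤n
true⇒1≤count {suc n} f (Fin.suc p) fp = ℕ.≤-trans (true⇒1≤count (f ∘ Fin.suc) p fp) (ℕ.m≤n+m _ _)

count≤1 : ∀ {n} (f : Fin n → Bool) → (∀ i j → f i ≡ true → f j ≡ true → i ≡ j) → count f ≤ 1
count≤1 {zero}  f atMostOne = z≤n
count≤1 {suc n} f atMostOne with f Fin.zero in f0
... | true  = ℕ.≤-reflexive (cong suc (count-false (f ∘ Fin.suc) rest-false))
  where
  rest-false : ∀ i → f (Fin.suc i) ≡ false
  rest-false i with f (Fin.suc i) in fi
  ... | false = refl
  ... | true with atMostOne Fin.zero (Fin.suc i) f0 fi
  ...   | ()
... | false = count≤1 (f ∘ Fin.suc) (λ i j fi fj → Finₚ.suc-injective (atMostOne _ _ fi fj))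

count+count-not : ∀ {n} (f : Fin n → Bool) → count f + count (not ∘ f) ≡ n
count+count-not {zero}  f = refl
count+count-not {suc n} f with f Fin.zero
... | true  = cong suc (count+count-not (f ∘ Fin.suc))
... | false = trans (ℕ.+-suc _ _) (cong suc (count+count-not (f ∘ Fin.suc)))

count-+-mono-≤ : ∀ {n} (f g h e : Fin n → Bool) → (∀ p → 𝟙 (f p) + 𝟙 (g p) ≤ 𝟙 (h p) + 𝟙 (e p)) →
                 count f + count g ≤ count h + count e
count-+-mono-≤ f g h e pointwise =
  subst₂ _≤_ (∑-distrib-+ (𝟙 ∘ f) (𝟙 ∘ g)) (∑-distrib-+ (𝟙 ∘ h) (𝟙 ∘ e)) (sum-mono-≤ pointwise)

⌈/⌉≤ : ∀ a b r → a ≤ r * b → ⌈ a / b ⌉ ≤ r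
⌈/⌉≤ a zero    r a≤r*0 = z≤n
⌈/⌉≤ a (suc b) r a≤r*b = ℕ.≤-pred (m<n*o⇒m/o<n (begin-strict
  a + b            ≤⟨ ℕ.+-monoˡ-≤ b a≤r*b ⟩
  r * suc b + b        <⟨ ℕ.n<1+n _ ⟩
  suc (r * suc b + b)  ≡⟨ cong suc (ℕ.+-comm (r * suc b) b) ⟩
  suc r * suc b        ∎))
  where
  open ℕ.≤-Reasoning

alternating-step : ∀ {w c a ℓᵢ ℓⱼ N fᵢ fⱼ x} → c ≤ w →
  w + ℓᵢ ≤ N + x → N + fⱼ ≤ fᵢ + ℓⱼ → a + ℓⱼ ≤ fⱼ + c → (w ∸ c) + a + ℓᵢ ≤ fᵢ + x
alternating-step {c = c} {a} {ℓᵢ} {ℓⱼ} {N} {fᵢ} {fⱼ} {x} c≤w firstBlock columns rest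
  with e , refl ← ℕ.m≤n⇒∃[o]m+o≡n c≤w
  rewrite ℕ.m+n∸m≡n c e = ℕ.+-cancelˡ-≤ (c + (N + fⱼ + ℓⱼ)) _ _ (subst₂ _≤_ (lhs c e ℓᵢ N fⱼ a ℓⱼ) (rhs N x fᵢ ℓⱼ fⱼ c)
    (ℕ.+-mono-≤ (ℕ.+-mono-≤ firstBlock columns) rest))
  where
  lhs : ∀ c e ℓᵢ N fⱼ a ℓⱼ → (c + e + ℓᵢ) + (N + fⱼ) + (a + ℓⱼ) ≡ (c + (N + fⱼ + ℓⱼ)) + (e + a + ℓᵢ)
  lhs = solve-∀
  rhs : ∀ N x fᵢ ℓⱼ fⱼ c → (N + x) + (fᵢ + ℓⱼ) + (fⱼ + c) ≡ (c + (N + fⱼ + ℓⱼ)) + (fᵢ + x)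
  rhs = solve-∀

altSum-shift : ∀ (w c : ℕ → ℕ) m → altSum w c (suc (suc m)) ≡ (w 1 ∸ c 1) + altSum (w ∘ suc) (c ∘ suc) (suc m)
altSum-shift w c m = trans (cong (_+ w (2 + m)) (altPrefix-shift m)) (ℕ.+-assoc (w 1 ∸ c 1) _ _)
  where
  altPrefix-shift : ∀ m → altPrefix w c (suc m) ≡ (w 1 ∸ c 1) + altPrefix (w ∘ suc) (c ∘ suc) m
  altPrefix-shift zero    = ℕ.+-comm 0 _
  altPrefix-shift (suc m) = trans (cong (_+ (w (2 + m) ∸ c (2 + m))) (altPrefix-shift m)) (ℕ.+-assoc (w 1 ∸ c 1) _ _)

private variable
  ℓᴬ ℓᴮ : Level
  A : Set ℓᴬ
  A′ : Set ℓᴮ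

countᴸ : (A → Bool) → List A → ℕ
countᴸ P []       = 0
countᴸ P (x ∷ xs) = 𝟙 (P x) + countᴸ P xs

countᴸ-++ : ∀ (P : A → Bool) xs ys → countᴸ P (xs ++ ys) ≡ countᴸ P xs + countᴸ P ys
countᴸ-++ P []       ys = refl
countᴸ-++ P (x ∷ xs) ys = trans (cong (𝟙 (P x) +_) (countᴸ-++ P xs ys)) (sym (ℕ.+-assoc (𝟙 (P x)) _ _))

countᴸ-cong : ∀ {P Q : A → Bool} → (∀ x → P x ≡ Q x) → ∀ xs → countᴸ P xs ≡ countᴸ Q xs
countᴸ-cong P≗Q []       = refl
countᴸ-cong P≗Q (x ∷ xs) = cong₂ _+_ (cong 𝟙 (P≗Q x)) (countᴸ-cong P≗Q xs)

countᴸ-const : ∀ b (xs : List A) → countᴸ (λ _ → b) xs ≡ 𝟙 b * length xs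
countᴸ-const b []       = sym (ℕ.*-zeroʳ (𝟙 b))
countᴸ-const b (x ∷ xs) = trans (cong (𝟙 b +_) (countᴸ-const b xs)) (sym (ℕ.*-suc (𝟙 b) (length xs)))

countᴸ-concat-tabulate : ∀ {m} (P : A → Bool) (g : Fin m → List A) →
  countᴸ P (concat (tabulate g)) ≡ sum (λ j → countᴸ P (g j))
countᴸ-concat-tabulate {m = zero}  P g = refl
countᴸ-concat-tabulate {m = suc m} P g =
  trans (countᴸ-++ P (g Fin.zero) _) (cong (countᴸ P (g Fin.zero) +_) (countᴸ-concat-tabulate P (g ∘ Fin.suc)))

countᴸ-concat-replicate : ∀ (P : A → Bool) r xs → countᴸ P (concat (replicate r xs)) ≡ r * countᴸ P xs
countᴸ-concat-replicate P zero    xs = refl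
countᴸ-concat-replicate P (suc r) xs = trans (countᴸ-++ P xs _) (cong (countᴸ P xs +_) (countᴸ-concat-replicate P r xs))

length-concat-replicate : ∀ r (xs : List A) → length (concat (replicate r xs)) ≡ r * length xs
length-concat-replicate zero    xs = refl
length-concat-replicate (suc r) xs = trans (length-++ xs) (cong (length xs +_) (length-concat-replicate r xs))

countᴸ-map : ∀ (P : A′ → Bool) (f : A → A′) xs → countᴸ P (map f xs) ≡ countᴸ (P ∘ f) xs
countᴸ-map P f []       = refl
countᴸ-map P f (x ∷ xs) = cong (𝟙 (P (f x)) +_) (countᴸ-map P f xs)

module OverField {c ℓ′} (R : CommutativeRing c ℓ′) (isField : IsField R)
                    (_≟_ : Decidable (CommutativeRing._≈_ R)) where
  open CommutativeRing R
    renaming (_+_ to _⊕_; _*_ to _⊛_; -_ to ⊝_; refl to ≈-refl; sym to ≈-sym; trans to ≈-trans;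
              reflexive to ≈-reflexive; zero to *-zero;
              setoid to ≈-setoid)
  open Coding R _≟_
  open import Algebra.Properties.Semiring.Sum semiring
    using () renaming (sum to ∑ᶠ; sum-cong-≋ to ∑ᶠ-cong; sum-replicate-zero to ∑ᶠ-zero;
                       sum-remove to ∑ᶠ-remove; ∑-comm to ∑ᶠ-comm;
                       *-distribˡ-sum to *-distribˡ-∑ᶠ; *-distribʳ-sum to *-distribʳ-∑ᶠ)
  open import Algebra.Properties.Ring ring using (-‿distribˡ-*)
  open import Algebra.Properties.AbelianGroup +-abelianGroup using (inverseˡ-unique)
  private module ≈-Reasoning = Relation.Binary.Reasoning.Setoid ≈-setoid

  nonzero? : Carrier → Bool
  nonzero? u = not (does (u ≟ 0#))

  ≈0⇒nonzero?≡false : ∀ {u} → u ≈ 0# → nonzero? u ≡ false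
  ≈0⇒nonzero?≡false {u} u≈0 with u ≟ 0#
  ... | yes _   = refl
  ... | no u≉0  = ⊥-elim (u≉0 u≈0)

  ≉0⇒nonzero?≡true : ∀ {u} → ¬ u ≈ 0# → nonzero? u ≡ true
  ≉0⇒nonzero?≡true {u} u≉0 with u ≟ 0#
  ... | yes u≈0 = ⊥-elim (u≉0 u≈0)
  ... | no _    = refl

  nonzero?≡false⇒≈0 : ∀ {u} → nonzero? u ≡ false → u ≈ 0#
  nonzero?≡false⇒≈0 {u} _ with u ≟ 0#
  ... | yes u≈0 = u≈0

  nonzero?≡true⇒≉0 : ∀ {u} → nonzero? u ≡ true → ¬ u ≈ 0#
  nonzero?≡true⇒≉0 {u} _ with u ≟ 0#
  ... | no u≉0 = u≉0

  nonzero?-cong : ∀ {u v} → u ≈ v → nonzero? u ≡ nonzero? v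
  nonzero?-cong {u} {v} u≈v with u ≟ 0# | v ≟ 0#
  ... | yes _   | yes _   = refl
  ... | no _    | no _    = refl
  ... | yes u≈0 | no v≉0  = ⊥-elim (v≉0 (≈-trans (≈-sym u≈v) u≈0))
  ... | no u≉0  | yes v≈0 = ⊥-elim (u≉0 (≈-trans u≈v v≈0))

  1≉0 : ¬ 1# ≈ 0#
  1≉0 = proj₁ isField

  *-cancelʳ : ∀ {x α β} → ¬ x ≈ 0# → α ⊛ x ≈ β ⊛ x → α ≈ β
  *-cancelʳ {x} {α} {β} x≉0 αx≈βx with proj₂ isField x x≉0
  ... | x⁻¹ , xx⁻¹≈1 = begin
    α               ≈⟨ ≈-sym (*-identityʳ α) ⟩
    α ⊛ 1#          ≈⟨ *-congˡ (≈-sym xx⁻¹≈1) ⟩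
    α ⊛ (x ⊛ x⁻¹)   ≈⟨ ≈-sym (*-assoc α x x⁻¹) ⟩
    (α ⊛ x) ⊛ x⁻¹   ≈⟨ *-congʳ αx≈βx ⟩
    (β ⊛ x) ⊛ x⁻¹   ≈⟨ *-assoc β x x⁻¹ ⟩
    β ⊛ (x ⊛ x⁻¹)   ≈⟨ *-congˡ xx⁻¹≈1 ⟩
    β ⊛ 1#          ≈⟨ *-identityʳ β ⟩
    β               ∎
    where open ≈-Reasoning

  *≈0⇒≈0 : ∀ {x α} → ¬ x ≈ 0# → α ⊛ x ≈ 0# → α ≈ 0#
  *≈0⇒≈0 {x} x≉0 αx≈0 = *-cancelʳ x≉0 (≈-trans αx≈0 (≈-sym (zeroˡ x)))

  linearRoot : ∀ {x} y → ¬ x ≈ 0# → Σ Carrier λ α → (α ⊛ x) ⊕ y ≈ 0#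
  linearRoot {x} y x≉0 with proj₂ isField x x≉0
  ... | x⁻¹ , xx⁻¹≈1 = ⊝ (y ⊛ x⁻¹) , (begin
    (⊝ (y ⊛ x⁻¹) ⊛ x) ⊕ y   ≈⟨ +-congʳ (≈-sym (-‿distribˡ-* (y ⊛ x⁻¹) x)) ⟩
    ⊝ ((y ⊛ x⁻¹) ⊛ x) ⊕ y   ≈⟨ +-congʳ (-‿cong (*-assoc y x⁻¹ x)) ⟩
    ⊝ (y ⊛ (x⁻¹ ⊛ x)) ⊕ y   ≈⟨ +-congʳ (-‿cong (*-congˡ (≈-trans (*-comm x⁻¹ x) xx⁻¹≈1))) ⟩
    ⊝ (y ⊛ 1#) ⊕ y          ≈⟨ +-congʳ (-‿cong (*-identityʳ y)) ⟩
    ⊝ y ⊕ y                 ≈⟨ -‿inverseˡ y ⟩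
    0#                      ∎)
    where open ≈-Reasoning

  linearRoot-unique : ∀ {x y α β} → ¬ x ≈ 0# → (α ⊛ x) ⊕ y ≈ 0# → (β ⊛ x) ⊕ y ≈ 0# → α ≈ β
  linearRoot-unique x≉0 αroot βroot =
    *-cancelʳ x≉0 (≈-trans (inverseˡ-unique _ _ αroot) (≈-sym (inverseˡ-unique _ _ βroot)))

  wt≡count : ∀ {n} (x : Vect n) → wt x ≡ count (nz x)
  wt≡count {zero}  x = refl
  wt≡count {suc n} x = cong (𝟙 (nz x Fin.zero) +_) (wt≡count (x ∘ Fin.suc))

  wt-cong : ∀ {n} {x y : Vect n} → (∀ j → x j ≈ y j) → wt x ≡ wt y
  wt-cong {zero}  x≈y = refl
  wt-cong {suc n} x≈y = cong₂ _+_ (cong 𝟙 (nonzero?-cong (x≈y Fin.zero))) (wt-cong (x≈y ∘ Fin.suc))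

  wt≤n : ∀ {n} (x : Vect n) → wt x ≤ n
  wt≤n x = subst (_≤ _) (sym (wt≡count x)) (count≤n (nz x))

  IsZeroVec⇒wt≡0 : ∀ {n} {x : Vect n} → IsZeroVec x → wt x ≡ 0
  IsZeroVec⇒wt≡0 {x = x} x≈0 = trans (wt≡count x) (count-false (nz x) (≈0⇒nonzero?≡false ∘ x≈0))

  wt≡0⇒IsZeroVec : ∀ {n} {x : Vect n} → wt x ≡ 0 → IsZeroVec x
  wt≡0⇒IsZeroVec {suc n} {x} wt≡0 j with nz x Fin.zero in x₀
  wt≡0⇒IsZeroVec {suc n} {x} wt≡0 Fin.zero    | false = nonzero?≡false⇒≈0 x₀
  wt≡0⇒IsZeroVec {suc n} {x} wt≡0 (Fin.suc j) | false = wt≡0⇒IsZeroVec wt≡0 j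

  support : ∀ {n} {x : Vect n} → ¬ IsZeroVec x → Σ (Fin n) λ p → nz x p ≡ true
  support {x = x} x≉0 = count≢0⇒∃true (nz x) (λ count≡0 → x≉0 (wt≡0⇒IsZeroVec (trans (wt≡count x) count≡0)))

  ¬IsZeroVec⇒1≤wt : ∀ {n} {x : Vect n} → ¬ IsZeroVec x → 1 ≤ wt x
  ¬IsZeroVec⇒1≤wt {x = x} x≉0 =
    subst (1 ≤_) (sym (wt≡count x)) (true⇒1≤count (nz x) _ (proj₂ (support x≉0)))

  1≤wt⇒¬IsZeroVec : ∀ {n} {x : Vect n} → 1 ≤ wt x → ¬ IsZeroVec x
  1≤wt⇒¬IsZeroVec 1≤wt x≈0 with () ← ℕ.<⇒≢ 1≤wt (sym (IsZeroVec⇒wt≡0 x≈0))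

  IsZeroVec? : ∀ {n} (x : Vect n) → Dec (IsZeroVec x)
  IsZeroVec? x with wt x ℕ.≟ 0
  ... | yes wt≡0 = yes (wt≡0⇒IsZeroVec wt≡0)
  ... | no  wt≢0 = no (wt≢0 ∘ IsZeroVec⇒wt≡0)

  dot : ∀ {r} → (Fin r → Carrier) → (Fin r → Carrier) → Carrier
  dot a u = ∑ᶠ (λ l → a l ⊛ u l)

  linComb≡dot : ∀ {k n} (a : Fin k → Carrier) (v : Fin k → Vect n) j → linComb a v j ≡ dot a (λ l → v l j)
  linComb≡dot {zero}  a v j = refl
  linComb≡dot {suc k} a v j = cong (a Fin.zero ⊛ v Fin.zero j ⊕_) (linComb≡dot (a ∘ Fin.suc) (v ∘ Fin.suc) j)

  dot-cong : ∀ {r} {a a′ u u′ : Fin r → Carrier} → (∀ l → a l ≈ a′ l) → (∀ l → u l ≈ u′ l) → dot a u ≈ dot a′ u′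
  dot-cong a≈a′ u≈u′ = ∑ᶠ-cong (λ l → *-cong (a≈a′ l) (u≈u′ l))

  dot-≈0 : ∀ {r} (a u : Fin r → Carrier) → (∀ l → a l ⊛ u l ≈ 0#) → dot a u ≈ 0#
  dot-≈0 {r} a u terms≈0 = ≈-trans (∑ᶠ-cong terms≈0) (∑ᶠ-zero r)

  dot-zeroˡ : ∀ {r} (a u : Fin r → Carrier) → (∀ l → a l ≈ 0#) → dot a u ≈ 0#
  dot-zeroˡ a u a≈0 = dot-≈0 a u (λ l → ≈-trans (*-congʳ (a≈0 l)) (zeroˡ (u l)))

  dot-zeroʳ : ∀ {r} (a u : Fin r → Carrier) → (∀ l → u l ≈ 0#) → dot a u ≈ 0#
  dot-zeroʳ a u u≈0 = dot-≈0 a u (λ l → ≈-trans (*-congˡ (u≈0 l)) (zeroʳ (a l)))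

  dot-single : ∀ {r} (a u : Fin r → Carrier) (l : Fin r) → (∀ l′ → l′ ≢ l → a l′ ⊛ u l′ ≈ 0#) → dot a u ≈ a l ⊛ u l
  dot-single {suc r} a u l others≈0 = begin
    dot a u                                               ≈⟨ ∑ᶠ-remove {i = l} (λ t → a t ⊛ u t) ⟩
    a l ⊛ u l ⊕ ∑ᶠ (λ t → a (punchIn l t) ⊛ u (punchIn l t)) ≈⟨ +-congˡ (∑ᶠ-cong (λ t → others≈0 _ (Finₚ.punchInᵢ≢i l t))) ⟩
    a l ⊛ u l ⊕ ∑ᶠ {r} (λ _ → 0#)                          ≈⟨ +-congˡ (∑ᶠ-zero r) ⟩
    a l ⊛ u l ⊕ 0#                                         ≈⟨ +-identityʳ _ ⟩
    a l ⊛ u l                                              ∎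
    where open ≈-Reasoning

  unit : ∀ {r} → Fin r → Fin r → Carrier
  unit s t = if does (s Finₚ.≟ t) then 1# else 0#

  unit-≢ : ∀ {r} {s t : Fin r} → s ≢ t → unit s t ≈ 0#
  unit-≢ {s = s} {t} s≢t with s Finₚ.≟ t
  ... | yes s≡t = ⊥-elim (s≢t s≡t)
  ... | no _    = ≈-refl

  dot-unit : ∀ {r} (s : Fin r) (u : Fin r → Carrier) → dot (unit s) u ≈ u s
  dot-unit s u = ≈-trans (dot-single (unit s) u s off) (≈-trans (*-congʳ on) (*-identityˡ (u s)))
    where
    on : unit s s ≈ 1#
    on with s Finₚ.≟ s
    ... | yes _  = ≈-refl
    ... | no s≢s = ⊥-elim (s≢s refl)
    off : ∀ t → t ≢ s → unit s t ⊛ u t ≈ 0#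
    off t t≢s = ≈-trans (*-congʳ (unit-≢ (t≢s ∘ sym))) (zeroˡ (u t))

  dot-assoc : ∀ {r K} (a : Fin r → Carrier) (M : Fin r → Fin K → Carrier) (u : Fin K → Carrier) →
              dot (λ t → dot a (λ l → M l t)) u ≈ dot a (λ l → dot (M l) u)
  dot-assoc a M u = begin
    ∑ᶠ (λ t → ∑ᶠ (λ l → a l ⊛ M l t) ⊛ u t)    ≈⟨ ∑ᶠ-cong (λ t → *-distribʳ-∑ᶠ (u t) (λ l → a l ⊛ M l t)) ⟩
    ∑ᶠ (λ t → ∑ᶠ (λ l → (a l ⊛ M l t) ⊛ u t))  ≈⟨ ∑ᶠ-comm (λ t l → (a l ⊛ M l t) ⊛ u t) ⟩
    ∑ᶠ (λ l → ∑ᶠ (λ t → (a l ⊛ M l t) ⊛ u t))  ≈⟨ ∑ᶠ-cong (λ l → ∑ᶠ-cong (λ t → *-assoc (a l) (M l t) (u t))) ⟩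
    ∑ᶠ (λ l → ∑ᶠ (λ t → a l ⊛ (M l t ⊛ u t)))  ≈⟨ ∑ᶠ-cong (λ l → ≈-sym (*-distribˡ-∑ᶠ (a l) (λ t → M l t ⊛ u t))) ⟩
    ∑ᶠ (λ l → a l ⊛ dot (M l) u)              ∎
    where open ≈-Reasoning

  anyBelow≡true⇒∃ : ∀ {K} i (P : Fin K → Bool) → anyBelow i P ≡ true → Σ (Fin K) λ r → toℕ r < i × P r ≡ true
  anyBelow≡true⇒∃ {suc K} (suc i) P any≡true with P Fin.zero in P₀
  ... | true  = Fin.zero , s≤s z≤n , P₀
  ... | false with anyBelow≡true⇒∃ i (P ∘ Fin.suc) any≡true
  ...   | r , r<i , Pr = Fin.suc r , s≤s r<i , Pr

  anyBelow-intro : ∀ {K} i (P : Fin K → Bool) (r : Fin K) → toℕ r < i → P r ≡ true → anyBelow i P ≡ true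
  anyBelow-intro {suc K} (suc i) P Fin.zero    r<i Pr rewrite Pr = refl
  anyBelow-intro {suc K} (suc i) P (Fin.suc r) (s≤s r<i) Pr with P Fin.zero
  ... | true  = refl
  ... | false = anyBelow-intro i (P ∘ Fin.suc) r r<i Pr

  anyBelow≡false⇒ : ∀ {K} i (P : Fin K → Bool) → anyBelow i P ≡ false → ∀ r → toℕ r < i → P r ≡ false
  anyBelow≡false⇒ i P any≡false r r<i with P r in Pr
  ... | false = refl
  ... | true with () ← trans (sym (anyBelow-intro i P r r<i Pr)) any≡false

  anyBelow-mono : ∀ {K} {i j} (P : Fin K → Bool) → i ≤ j → anyBelow j P ≡ false → anyBelow i P ≡ false
  anyBelow-mono {i = i} {j} P i≤j any≡false with anyBelow i P in anyᵢ
  ... | false = refl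
  ... | true with r , r<i , Pr ← anyBelow≡true⇒∃ i P anyᵢ
    with () ← trans (sym (anyBelow-intro j P r (ℕ.≤-trans r<i i≤j) Pr)) any≡false

  anyBelow-extend : ∀ {K} i (P : Fin K → Bool) (r : Fin K) → toℕ r ≡ i → anyBelow i P ≡ false → P r ≡ false →
    anyBelow (suc i) P ≡ false
  anyBelow-extend i P r r≡i any≡false Pr≡false with anyBelow (suc i) P in any′
  ... | false = refl
  ... | true with r′ , r′<1+i , Pr′ ← anyBelow≡true⇒∃ (suc i) P any′ with ℕ.m≤n⇒m<n∨m≡n (ℕ.≤-pred r′<1+i)
  ...   | inj₁ r′<i with () ← trans (sym Pr′) (anyBelow≡false⇒ i P any≡false r′ r′<i)
  ...   | inj₂ r′≡i with () ← trans (sym Pr′) (subst (λ t → P t ≡ false) (Finₚ.toℕ-injective (trans r≡i (sym r′≡i))) Pr≡false)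

  staircase⇒LinIndep : ∀ {r n} (v : Fin r → Vect n) →
    (∀ l → Σ (Fin n) λ p → ¬ v l p ≈ 0# × (∀ l′ → toℕ l′ < toℕ l → v l′ p ≈ 0#)) → LinIndep v
  staircase⇒LinIndep v pivot a combination≈0 l = vanish (>-wellFounded l)
    where
    vanish : ∀ {l} → Acc Fin._>_ l → a l ≈ 0#
    vanish {l} (acc later) with pivot l
    ... | p , vlp≉0 , earlier≈0 = *≈0⇒≈0 vlp≉0 (begin
      a l ⊛ v l p             ≈⟨ ≈-sym (dot-single a (λ t → v t p) l others≈0) ⟩
      dot a (λ t → v t p)     ≈⟨ ≈-sym (≈-reflexive (linComb≡dot a v p)) ⟩
      linComb a v p           ≈⟨ combination≈0 p ⟩
      0#                      ∎)
      where
      open ≈-Reasoning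
      others≈0 : ∀ l′ → l′ ≢ l → a l′ ⊛ v l′ p ≈ 0#
      others≈0 l′ l′≢l with ℕ.<-cmp (toℕ l′) (toℕ l)
      ... | tri< l′<l _ _ = ≈-trans (*-congˡ (earlier≈0 l′ l′<l)) (zeroʳ (a l′))
      ... | tri≈ _ l′≡l _ = ⊥-elim (l′≢l (Finₚ.toℕ-injective l′≡l))
      ... | tri> _ _ l′>l = ≈-trans (*-congʳ (vanish (later l′>l))) (zeroˡ (v l′ p))

  GeneratesCode : ∀ {K n} → (Fin K → Vect n) → ℕ → Set (c ⊔ ℓ′)
  GeneratesCode G d =
      LinIndep G
    × (Σ (Fin _ → Carrier) λ a → ¬ IsZeroVec (linComb a G) × wt (linComb a G) ≡ d)
    × (∀ a → ¬ IsZeroVec (linComb a G) → d ≤ wt (linComb a G))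

  HasCode⇒d≤n : ∀ {n k d} → HasCode n k d → d ≤ n
  HasCode⇒d≤n (G , _ , (a , _ , wt≡d) , _) = subst (_≤ _) wt≡d (wt≤n (linComb a G))

  IsS⇒1≤d : ∀ {d k s} → IsS d k s → 1 ≤ d
  IsS⇒1≤d ((G , _ , (a , a≉0 , wt≡d) , _) , _) = subst (1 ≤_) wt≡d (¬IsZeroVec⇒1≤wt a≉0)

  GeneratesCode-transport : ∀ {K n n′ d} {G : Fin K → Vect n} {G′ : Fin K → Vect n′} →
    (∀ a → wt (linComb a G′) ≡ wt (linComb a G)) → GeneratesCode G d → GeneratesCode G′ d
  GeneratesCode-transport {G = G} {G′} wt′≡wt (indep , (a₀ , a₀≉0 , wt≡d) , minimal) =
    (λ a z → indep a (zero′⇒zero a z)) ,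
    (a₀ , (λ z → a₀≉0 (zero′⇒zero a₀ z)) , trans (wt′≡wt a₀) wt≡d) ,
    (λ a nonzero′ → subst (_ ≤_) (sym (wt′≡wt a)) (minimal a (nonzero′ ∘ zero⇒zero′ a)))
    where
    zero′⇒zero : ∀ a → IsZeroVec (linComb a G′) → IsZeroVec (linComb a G)
    zero′⇒zero a z = wt≡0⇒IsZeroVec (trans (sym (wt′≡wt a)) (IsZeroVec⇒wt≡0 z))
    zero⇒zero′ : ∀ a → IsZeroVec (linComb a G) → IsZeroVec (linComb a G′)
    zero⇒zero′ a z = wt≡0⇒IsZeroVec (trans (wt′≡wt a) (IsZeroVec⇒wt≡0 z))

  wt-punchIn : ∀ {n} (x : Vect (suc n)) p → wt x ≡ 𝟙 (nz x p) + wt (x ∘ punchIn p)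
  wt-punchIn x p = begin
    wt x                                  ≡⟨ wt≡count x ⟩
    count (nz x)                          ≡⟨ sum-remove {i = p} (𝟙 ∘ nz x) ⟩
    𝟙 (nz x p) + count (nz x ∘ punchIn p) ≡⟨ cong (𝟙 (nz x p) +_) (sym (wt≡count (x ∘ punchIn p))) ⟩
    𝟙 (nz x p) + wt (x ∘ punchIn p)       ∎
    where open ≡-Reasoning

  linComb-column-cong : ∀ {K n n′} a (G : Fin K → Vect n) (G′ : Fin K → Vect n′) j j′ →
    (∀ l → G l j ≈ G′ l j′) → linComb a G j ≈ linComb a G′ j′
  linComb-column-cong a G G′ j j′ columns≈ = begin
    linComb a G j             ≡⟨ linComb≡dot a G j ⟩
    dot a (λ l → G l j)       ≈⟨ dot-cong (λ l → ≈-refl) columns≈ ⟩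
    dot a (λ l → G′ l j′)     ≡⟨ linComb≡dot a G′ j′ ⟨
    linComb a G′ j′           ∎
    where open ≈-Reasoning

  deleteColumn : ∀ {K n} → Fin (suc n) → (Fin K → Vect (suc n)) → Fin K → Vect n
  deleteColumn p G l = G l ∘ punchIn p

  wt-deleteColumn : ∀ {K n} (p : Fin (suc n)) (G : Fin K → Vect (suc n)) a →
    wt (linComb a G) ≡ 𝟙 (nz (linComb a G) p) + wt (linComb a (deleteColumn p G))
  wt-deleteColumn p G a = trans (wt-punchIn (linComb a G) p)
    (cong (𝟙 (nz (linComb a G) p) +_) (wt-cong (λ j → linComb-column-cong a G (deleteColumn p G) (punchIn p j) j (λ l → ≈-refl))))

  puncture : ∀ {n k d} → HasCode (suc n) k (suc d) → 1 ≤ d → HasCode n k d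
  puncture {d = d} (G , indep , (a₀ , a₀≉0 , wt≡1+d) , minimal) 1≤d
    with p , p∈supp ← support a₀≉0 = G′ , indep′ , (a₀ , a₀≉0′ , wt′≡d) , minimal′
    where
    G′ = deleteColumn p G
    wt≤1+wt′ : ∀ a → wt (linComb a G) ≤ suc (wt (linComb a G′))
    wt≤1+wt′ a = subst (_≤ suc (wt (linComb a G′))) (sym (wt-deleteColumn p G a))
                 (ℕ.+-monoˡ-≤ (wt (linComb a G′)) (𝟙≤1 (nz (linComb a G) p)))
    wt′≡d : wt (linComb a₀ G′) ≡ d
    wt′≡d = ℕ.suc-injective (trans (sym (trans (wt-deleteColumn p G a₀) (cong (λ b → 𝟙 b + wt (linComb a₀ G′)) p∈supp))) wt≡1+d)
    a₀≉0′ : ¬ IsZeroVec (linComb a₀ G′)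
    a₀≉0′ = 1≤wt⇒¬IsZeroVec (subst (1 ≤_) (sym wt′≡d) 1≤d)
    minimal′ : ∀ a → ¬ IsZeroVec (linComb a G′) → d ≤ wt (linComb a G′)
    minimal′ a nonzero′ = ℕ.≤-pred (ℕ.≤-trans (minimal a (nonzero′ ∘ zero⇒zero′)) (wt≤1+wt′ a))
      where
      zero⇒zero′ : IsZeroVec (linComb a G) → IsZeroVec (linComb a G′)
      zero⇒zero′ z j = ≈-trans (linComb-column-cong a G′ G j (punchIn p j) (λ l → ≈-refl)) (z (punchIn p j))
    indep′ : LinIndep G′
    indep′ a z with IsZeroVec? (linComb a G)
    ... | yes isZero  = indep a isZero
    ... | no  nonzero = ⊥-elim (ℕ.<⇒≱ (s≤s 1≤d) (ℕ.≤-trans (minimal a nonzero)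
          (subst (λ w → wt (linComb a G) ≤ suc w) (IsZeroVec⇒wt≡0 z) (wt≤1+wt′ a))))

  puncture* : ∀ e {n k d} → HasCode (e + n) k (e + d) → 1 ≤ d → HasCode n k d
  puncture* zero            code 1≤d = code
  puncture* (suc e) {d = d} code 1≤d = puncture* e (puncture code (ℕ.≤-trans 1≤d (ℕ.m≤n+m d e))) 1≤d

  IsS-puncture-bound : ∀ {n k d x s} → HasCode n k d → 1 ≤ x → x ≤ d → IsS x k s → s + d ≤ n + x
  IsS-puncture-bound {n} {k} {d} {x} {s} code 1≤x x≤d (_ , minimal) = begin
    s + d              ≡⟨ cong (s +_) d≡e+x ⟩
    s + (e + x)        ≤⟨ ℕ.+-monoˡ-≤ (e + x) s≤n∸e ⟩
    (n ∸ e) + (e + x)  ≡⟨ sym (ℕ.+-assoc (n ∸ e) e x) ⟩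
    (n ∸ e) + e + x    ≡⟨ cong (_+ x) (ℕ.m∸n+n≡m e≤n) ⟩
    n + x              ∎
    where
    open ℕ.≤-Reasoning
    e = d ∸ x
    d≡e+x : d ≡ e + x
    d≡e+x = sym (ℕ.m∸n+n≡m x≤d)
    e≤n : e ≤ n
    e≤n = ℕ.≤-trans (ℕ.m∸n≤m d x) (HasCode⇒d≤n code)
    punctured : HasCode (n ∸ e) k x
    punctured = puncture* e (subst₂ (λ n′ d′ → HasCode n′ k d′) (sym (ℕ.m+[n∸m]≡n e≤n)) d≡e+x code) 1≤x
    s≤n∸e : s ≤ n ∸ e
    s≤n∸e = ℕ.≮⇒≥ (λ n∸e<s → minimal (n ∸ e) n∸e<s punctured)

  nonzeroColumn : ∀ {K n} → (Fin K → Vect n) → Fin n → Bool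
  nonzeroColumn {K} G p = anyBelow K (λ l → nz (G l) p)

  dropZeroColumns : ∀ {K n} (G : Fin K → Vect n) →
    Σ (Fin K → Vect (count (nonzeroColumn G))) λ G′ → ∀ a → wt (linComb a G′) ≡ wt (linComb a G)
  dropZeroColumns {n = zero}  G = G , λ a → refl
  dropZeroColumns {K} {suc n} G with dropZeroColumns (λ l → G l ∘ Fin.suc) | nonzeroColumn G Fin.zero in G₀
  ... | G′ , wt′≡wt | true  = G″ , λ a → cong₂ _+_
      (cong 𝟙 (nonzero?-cong (linComb-column-cong a G″ G Fin.zero Fin.zero (λ l → ≈-refl))))
      (trans (wt-cong (λ j → linComb-column-cong a G″ G′ (Fin.suc j) j (λ l → ≈-refl)))
        (trans (wt′≡wt a) (wt-cong (λ j → linComb-column-cong a (λ l → G l ∘ Fin.suc) G j (Fin.suc j) (λ l → ≈-refl)))))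
    where
    G″ : Fin K → Vect (suc _)
    G″ l Fin.zero    = G l Fin.zero
    G″ l (Fin.suc j) = G′ l j
  ... | G′ , wt′≡wt | false = G′ , λ a → trans (wt′≡wt a)
      (trans (wt-cong (λ j → linComb-column-cong a (λ l → G l ∘ Fin.suc) G j (Fin.suc j) (λ l → ≈-refl)))
        (cong (λ b → 𝟙 b + wt (λ j → linComb a G (Fin.suc j))) (sym (≈0⇒nonzero?≡false
          (≈-trans (≈-reflexive (linComb≡dot a G Fin.zero)) (dot-zeroʳ a (λ l → G l Fin.zero) column₀≈0))))))
    where
    column₀≈0 : ∀ l → G l Fin.zero ≈ 0#
    column₀≈0 l = nonzero?≡false⇒≈0 (anyBelow≡false⇒ K (λ l → nz (G l) Fin.zero) G₀ l (Finₚ.toℕ<n l))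

  head≉0 : ∀ {s} {a : Fin (suc s) → Carrier} → ¬ (∀ l → a l ≈ 0#) → (∀ l → a (Fin.suc l) ≈ 0#) → ¬ a Fin.zero ≈ 0#
  head≉0 a≉0 tail≈0 head≈0 = a≉0 λ { Fin.zero → head≈0 ; (Fin.suc l) → tail≈0 l }

  module FiniteField (q : ℕ)
    (enumeration : Bijection ≈-setoid (setoid (Fin q))) where
    open Bijection enumeration using (to; to⁻; surjection) renaming (cong to to-cong)
    open Surjection surjection using (to∘to⁻)

    element : Fin q → Carrier
    element = to⁻

    element∘to : ∀ α → element (to α) ≈ α
    element∘to α = Bijection.injective enumeration (to∘to⁻ (to α))

    element-injective : ∀ {i j} → element i ≈ element j → i ≡ j
    element-injective {i} {j} eq = trans (sym (to∘to⁻ i)) (trans (to-cong eq) (to∘to⁻ j))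

    1≤q : 1 ≤ q
    1≤q = inhabited (to 0#)
      where
      inhabited : ∀ {m} → Fin m → 1 ≤ m
      inhabited Fin.zero    = s≤s z≤n
      inhabited (Fin.suc _) = s≤s z≤n

    instance
      q-nonZero : NonZero q
      q-nonZero = >-nonZero 1≤q

    nonroots<q : ∀ {u} v → ¬ u ≈ 0# → count (λ j → nonzero? (element j ⊛ u ⊕ v)) < q
    nonroots<q {u} v u≉0 with α , αu+v≈0 ← linearRoot v u≉0 =
      count<n (λ j → nonzero? (element j ⊛ u ⊕ v)) (to α)
        (≈0⇒nonzero?≡false (≈-trans (+-congʳ (*-congʳ (element∘to α))) αu+v≈0))

    q≤nonroots+1 : ∀ {u} v → ¬ u ≈ 0# → q ≤ count (λ j → nonzero? (element j ⊛ u ⊕ v)) + 1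
    q≤nonroots+1 {u} v u≉0 = subst (_≤ count nonroot + 1) (count+count-not nonroot) (ℕ.+-monoʳ-≤ (count nonroot) roots≤1)
      where
      nonroot : Fin q → Bool
      nonroot j = nonzero? (element j ⊛ u ⊕ v)
      isRoot : ∀ {j} → not (nonroot j) ≡ true → element j ⊛ u ⊕ v ≈ 0#
      isRoot {j} e with nonroot j in e′
      ... | false = nonzero?≡false⇒≈0 e′
      roots≤1 : count (not ∘ nonroot) ≤ 1
      roots≤1 = count≤1 (not ∘ nonroot) λ i j rootᵢ rootⱼ →
        element-injective (linearRoot-unique u≉0 (isRoot rootᵢ) (isRoot rootⱼ))

    pencil-column : ∀ u v v′ → (u ≈ 0# → ¬ v ≈ 0# → ¬ v′ ≈ 0#) →
      count (λ j → nonzero? (element j ⊛ u ⊕ v)) + 𝟙 (nonzero? u) ≤ q * 𝟙 (nonzero? u) + q * 𝟙 (nonzero? v′)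
    pencil-column u v v′ v′≉0 with nonzero? u in u?
    ... | true  = ℕ.≤-trans (subst (_≤ q) (ℕ.+-comm 1 _) (nonroots<q v (nonzero?≡true⇒≉0 u?)))
                    (subst (λ t → q ≤ t + q * 𝟙 (nonzero? v′)) (sym (ℕ.*-identityʳ q)) (ℕ.m≤m+n q _))
    ... | false with nonzero? v in v?
    ...   | false = subst (λ t → t + 0 ≤ q * 0 + q * 𝟙 (nonzero? v′))
                      (sym (count-false _ (λ j → ≈0⇒nonzero?≡false (vanishes j)))) z≤n
      where
      vanishes : ∀ j → element j ⊛ u ⊕ v ≈ 0#
      vanishes j = ≈-trans (+-cong (≈-trans (*-congˡ (nonzero?≡false⇒≈0 u?)) (zeroʳ _)) (nonzero?≡false⇒≈0 v?))
                           (+-identityʳ 0#)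
    ...   | true
      rewrite ≉0⇒nonzero?≡true (v′≉0 (nonzero?≡false⇒≈0 u?) (nonzero?≡true⇒≉0 v?))
            | ℕ.*-zeroʳ q | ℕ.*-identityʳ q | ℕ.+-identityʳ (count (λ j → nonzero? (element j ⊛ u ⊕ v)))
            = count≤n _

    -- Where x p is nonzero, α x p + y p vanishes for exactly one α.
    pencil-weight : ∀ {n} (x y y′ : Vect n) → (∀ p → x p ≈ 0# → ¬ y p ≈ 0# → ¬ y′ p ≈ 0#) →
      sum (λ j → wt (λ p → element j ⊛ x p ⊕ y p)) + wt x ≤ q * wt x + q * wt y′
    pencil-weight {n} x y y′ y′≉0 = begin
      sum (λ j → wt (z j)) + wt x
        ≡⟨ cong₂ _+_ (trans (sum-cong-≗ (λ j → wt≡count (z j))) (∑-comm (λ j p → 𝟙 (nz (z j) p)))) (wt≡count x) ⟩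
      sum (λ p → count (λ j → nz (z j) p)) + count (nz x)
        ≡⟨ ∑-distrib-+ (λ p → count (λ j → nz (z j) p)) (𝟙 ∘ nz x) ⟨
      sum (λ p → count (λ j → nz (z j) p) + 𝟙 (nz x p))
        ≤⟨ sum-mono-≤ (λ p → pencil-column (x p) (y p) (y′ p) (y′≉0 p)) ⟩
      sum (λ p → q * 𝟙 (nz x p) + q * 𝟙 (nz y′ p))
        ≡⟨ ∑-distrib-+ (λ p → q * 𝟙 (nz x p)) (λ p → q * 𝟙 (nz y′ p)) ⟩
      sum (λ p → q * 𝟙 (nz x p)) + sum (λ p → q * 𝟙 (nz y′ p))
        ≡⟨ cong₂ _+_ (*-distribˡ-sum q (𝟙 ∘ nz x)) (*-distribˡ-sum q (𝟙 ∘ nz y′)) ⟨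
      q * count (nz x) + q * count (nz y′)
        ≡⟨ cong₂ (λ s t → q * s + q * t) (wt≡count x) (wt≡count y′) ⟨
      q * wt x + q * wt y′ ∎
      where
      open ℕ.≤-Reasoning
      z : Fin q → Vect n
      z j p = element j ⊛ x p ⊕ y p

    allVectors : ∀ s → List (Fin s → Carrier)
    allVectors zero    = V.[] ∷ []
    allVectors (suc s) = concat (tabulate λ j → map (element j V.∷_) (allVectors s))

    countᴸ-allVectors : ∀ s (P : (Fin (suc s) → Carrier) → Bool) →
      countᴸ P (allVectors (suc s)) ≡ sum {q} (λ j → countᴸ (λ v → P (element j V.∷ v)) (allVectors s))
    countᴸ-allVectors s P = trans (countᴸ-concat-tabulate P (λ j → map (element j V.∷_) (allVectors s)))
      (sum-cong-≗ {q} (λ j → countᴸ-map P (element j V.∷_) (allVectors s)))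

    length-allVectors : ∀ s → length (allVectors s) ≡ q ^ s
    length-allVectors zero    = refl
    length-allVectors (suc s) = begin
      length (allVectors (suc s))                   ≡⟨ trans (countᴸ-const true (allVectors (suc s))) (ℕ.*-identityˡ _) ⟨
      countᴸ (λ _ → true) (allVectors (suc s))      ≡⟨ countᴸ-allVectors s (λ _ → true) ⟩
      sum {q} (λ j → countᴸ (λ _ → true) (allVectors s)) ≡⟨ sum-cong-≗ {q} (λ j → trans (countᴸ-const true (allVectors s)) (ℕ.*-identityˡ _)) ⟩
      sum {q} (λ j → length (allVectors s))             ≡⟨ sum-const q _ ⟩
      q * length (allVectors s)                     ≡⟨ cong (q *_) (length-allVectors s) ⟩
      q ^ suc s                                     ∎
      where open ≡-Reasoning

    affineSlice : ∀ s → (Fin (suc s) → Carrier) → Carrier → Fin q → ℕ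
    affineSlice s a κ j = countᴸ (λ v → nonzero? (κ ⊕ (a Fin.zero ⊛ element j ⊕ dot (a ∘ Fin.suc) v))) (allVectors s)

    affineSlices-nonzeros-head : ∀ s (a : Fin (suc s) → Carrier) κ → ¬ a Fin.zero ≈ 0# → (∀ l → a (Fin.suc l) ≈ 0#) →
      q ^ suc s ≤ sum (affineSlice s a κ) + q ^ s
    affineSlices-nonzeros-head s a κ a₀≉0 a′≈0 = bound
      where
      a₀ = a Fin.zero
      nonroot : Fin q → Bool
      nonroot j = nonzero? (element j ⊛ a₀ ⊕ κ)
      slice≡ : ∀ j → affineSlice s a κ j ≡ 𝟙 (nonroot j) * q ^ s
      slice≡ j = trans (countᴸ-cong (λ v → nonzero?-cong (begin
                   κ ⊕ (a₀ ⊛ element j ⊕ dot (a ∘ Fin.suc) v) ≈⟨ +-congˡ (+-congˡ (dot-zeroˡ _ v a′≈0)) ⟩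
                   κ ⊕ (a₀ ⊛ element j ⊕ 0#)                 ≈⟨ +-congˡ (+-identityʳ _) ⟩
                   κ ⊕ a₀ ⊛ element j                        ≈⟨ +-comm κ _ ⟩
                   a₀ ⊛ element j ⊕ κ                        ≈⟨ +-congʳ (*-comm a₀ (element j)) ⟩
                   element j ⊛ a₀ ⊕ κ                        ∎)) (allVectors s))
                 (trans (countᴸ-const (nonroot j) (allVectors s)) (cong (𝟙 (nonroot j) *_) (length-allVectors s)))
        where open ≈-Reasoning
      bound : q ^ suc s ≤ sum (affineSlice s a κ) + q ^ s
      bound = begin
        q * q ^ s                                 ≤⟨ ℕ.*-monoˡ-≤ (q ^ s) (q≤nonroots+1 κ a₀≉0) ⟩
        (count nonroot + 1) * q ^ s               ≡⟨ ℕ.*-distribʳ-+ (q ^ s) (count nonroot) 1 ⟩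
        count nonroot * q ^ s + 1 * q ^ s         ≡⟨ cong₂ _+_ (*-distribʳ-sum (q ^ s) (𝟙 ∘ nonroot)) (ℕ.*-identityˡ (q ^ s)) ⟩
        sum (λ j → 𝟙 (nonroot j) * q ^ s) + q ^ s ≡⟨ cong (_+ q ^ s) (sum-cong-≗ {q} slice≡) ⟨
        sum (affineSlice s a κ) + q ^ s           ∎
        where open ℕ.≤-Reasoning

    affineSlices-nonzeros : ∀ s (a : Fin (suc s) → Carrier) κ → ¬ (∀ l → a l ≈ 0#) →
      q ^ suc s ≤ sum (affineSlice s a κ) + q ^ s
    affineSlices-nonzeros s a κ a≉0 with Finₚ.all? (λ l → a (Fin.suc l) ≟ 0#)
    affineSlices-nonzeros s        a κ a≉0 | yes a′≈0 = affineSlices-nonzeros-head s a κ (head≉0 a≉0 a′≈0) a′≈0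
    affineSlices-nonzeros zero     a κ a≉0 | no a′≉0 = ⊥-elim (a′≉0 λ ())
    affineSlices-nonzeros (suc s′) a κ a≉0 | no a′≉0 = begin
      q * q ^ suc s′                                  ≡⟨ sum-const q (q ^ suc s′) ⟨
      sum {q} (λ _ → q ^ suc s′)                      ≤⟨ sum-mono-≤ perSlice ⟩
      sum (λ j → affineSlice (suc s′) a κ j + q ^ s′) ≡⟨ ∑-distrib-+ (affineSlice (suc s′) a κ) (λ _ → q ^ s′) ⟩
      sum (affineSlice (suc s′) a κ) + sum {q} (λ _ → q ^ s′) ≡⟨ cong (sum (affineSlice (suc s′) a κ) +_) (sum-const q (q ^ s′)) ⟩
      sum (affineSlice (suc s′) a κ) + q * q ^ s′     ∎
      where
      open ℕ.≤-Reasoning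
      perSlice : ∀ j → q ^ suc s′ ≤ affineSlice (suc s′) a κ j + q ^ s′
      perSlice j = subst (λ t → q ^ suc s′ ≤ t + q ^ s′)
        (trans (sym (countᴸ-allVectors s′ (λ v → nonzero? ((κ ⊕ a Fin.zero ⊛ element j) ⊕ dot (a ∘ Fin.suc) v))))
          (countᴸ-cong (λ v → nonzero?-cong (+-assoc κ (a Fin.zero ⊛ element j) (dot (a ∘ Fin.suc) v)))
            (allVectors (suc s′))))
        (affineSlices-nonzeros s′ (a ∘ Fin.suc) (κ ⊕ a Fin.zero ⊛ element j) a′≉0)

    affine-nonzeros : ∀ s (a : Fin (suc s) → Carrier) κ → ¬ (∀ l → a l ≈ 0#) →
      q ^ suc s ≤ countᴸ (λ v → nonzero? (κ ⊕ dot a v)) (allVectors (suc s)) + q ^ s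
    affine-nonzeros s a κ a≉0 =
      subst (λ t → q ^ suc s ≤ t + q ^ s) (sym (countᴸ-allVectors s (λ v → nonzero? (κ ⊕ dot a v))))
        (affineSlices-nonzeros s a κ a≉0)

    -- One representative (first nonzero entry 1) of each point of the projective space over F of dimension s - 1:
    -- the columns of the simplex code.
    projectivePoints : ∀ s → List (Fin s → Carrier)
    projectivePoints zero    = []
    projectivePoints (suc s) = map (1# V.∷_) (allVectors s) ++ map (0# V.∷_) (projectivePoints s)

    length-projectivePoints : ∀ s → (q ∸ 1) * length (projectivePoints s) + 1 ≡ q ^ s
    length-projectivePoints zero    = cong (_+ 1) (ℕ.*-zeroʳ (q ∸ 1))
    length-projectivePoints (suc s) = begin
      (q ∸ 1) * length (projectivePoints (suc s)) + 1
        ≡⟨ cong (λ t → (q ∸ 1) * t + 1) (trans (length-++ (map (1# V.∷_) (allVectors s)))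
             (cong₂ _+_ (length-map (1# V.∷_) (allVectors s)) (length-map (0# V.∷_) (projectivePoints s)))) ⟩
      (q ∸ 1) * (length (allVectors s) + length (projectivePoints s)) + 1
        ≡⟨ regroup (q ∸ 1) (length (allVectors s)) (length (projectivePoints s)) ⟩
      (q ∸ 1) * length (allVectors s) + ((q ∸ 1) * length (projectivePoints s) + 1)
        ≡⟨ cong₂ (λ t u → (q ∸ 1) * t + u) (length-allVectors s) (length-projectivePoints s) ⟩
      (q ∸ 1) * q ^ s + q ^ s
        ≡⟨ cong ((q ∸ 1) * q ^ s +_) (ℕ.*-identityˡ (q ^ s)) ⟨
      (q ∸ 1) * q ^ s + 1 * q ^ s
        ≡⟨ ℕ.*-distribʳ-+ (q ^ s) (q ∸ 1) 1 ⟨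
      (q ∸ 1 + 1) * q ^ s
        ≡⟨ cong (_* q ^ s) (ℕ.m∸n+n≡m 1≤q) ⟩
      q ^ suc s ∎
      where
      open ≡-Reasoning
      regroup : ∀ m x y → m * (x + y) + 1 ≡ m * x + (m * y + 1)
      regroup = solve-∀

    countᴸ-projectivePoints : ∀ s (P : (Fin (suc s) → Carrier) → Bool) →
      countᴸ P (projectivePoints (suc s)) ≡
      countᴸ (λ v → P (1# V.∷ v)) (allVectors s) + countᴸ (λ v → P (0# V.∷ v)) (projectivePoints s)
    countᴸ-projectivePoints s P = trans (countᴸ-++ P (map (1# V.∷_) (allVectors s)) _)
      (cong₂ _+_ (countᴸ-map P (1# V.∷_) (allVectors s)) (countᴸ-map P (0# V.∷_) (projectivePoints s)))

    projective-nonzeros : ∀ s (a : Fin (suc s) → Carrier) → ¬ (∀ l → a l ≈ 0#) →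
      q ^ s ≤ countᴸ (λ v → nonzero? (dot a v)) (projectivePoints (suc s))
    projective-nonzeros s a a≉0 with Finₚ.all? (λ l → a (Fin.suc l) ≟ 0#)
    projective-nonzeros s a a≉0 | yes a′≈0 =
      subst (q ^ s ≤_) (sym (countᴸ-projectivePoints s (λ v → nonzero? (dot a v))))
        (ℕ.≤-trans (ℕ.≤-reflexive (sym allNonzero)) (ℕ.m≤m+n _ _))
      where
      a₀≉0 = head≉0 a≉0 a′≈0
      allNonzero : countᴸ (λ v → nonzero? (a Fin.zero ⊛ 1# ⊕ dot (a ∘ Fin.suc) v)) (allVectors s) ≡ q ^ s
      allNonzero = trans (countᴸ-cong (λ v → ≉0⇒nonzero?≡true λ a₀+dot≈0 → a₀≉0 (≈-trans (≈-sym
          (≈-trans (+-cong (*-identityʳ _) (dot-zeroˡ _ v a′≈0)) (+-identityʳ _))) a₀+dot≈0)) (allVectors s))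
        (trans (countᴸ-const true (allVectors s)) (trans (ℕ.*-identityˡ _) (length-allVectors s)))
    projective-nonzeros zero     a a≉0 | no a′≉0 = ⊥-elim (a′≉0 λ ())
    projective-nonzeros (suc s′) a a≉0 | no a′≉0 =
      subst (q ^ suc s′ ≤_) (sym (countᴸ-projectivePoints (suc s′) (λ v → nonzero? (dot a v))))
        (ℕ.≤-trans (affine-nonzeros s′ (a ∘ Fin.suc) (a Fin.zero ⊛ 1#) a′≉0) (ℕ.+-monoʳ-≤ _ tailBound))
      where
      tailBound : q ^ s′ ≤ countᴸ (λ v → nonzero? (a Fin.zero ⊛ 0# ⊕ dot (a ∘ Fin.suc) v)) (projectivePoints (suc s′))
      tailBound = subst (q ^ s′ ≤_)
        (countᴸ-cong (λ v → nonzero?-cong (≈-sym (≈-trans (+-congʳ (zeroʳ _)) (+-identityˡ _)))) (projectivePoints (suc s′)))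
        (projective-nonzeros s′ (a ∘ Fin.suc) a′≉0)

    projective-firstCoordinate : ∀ s → countᴸ (λ v → nonzero? (v Fin.zero)) (projectivePoints (suc s)) ≡ q ^ s
    projective-firstCoordinate s = begin
      countᴸ (λ v → nonzero? (v Fin.zero)) (projectivePoints (suc s))
        ≡⟨ countᴸ-projectivePoints s (λ v → nonzero? (v Fin.zero)) ⟩
      countᴸ (λ _ → nonzero? 1#) (allVectors s) + countᴸ (λ _ → nonzero? 0#) (projectivePoints s)
        ≡⟨ cong₂ _+_ (countᴸ-const (nonzero? 1#) (allVectors s)) (countᴸ-const (nonzero? 0#) (projectivePoints s)) ⟩
      𝟙 (nonzero? 1#) * length (allVectors s) + 𝟙 (nonzero? 0#) * length (projectivePoints s)
        ≡⟨ cong₂ (λ b b′ → 𝟙 b * length (allVectors s) + 𝟙 b′ * length (projectivePoints s))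
             (≉0⇒nonzero?≡true 1≉0) (≈0⇒nonzero?≡false ≈-refl) ⟩
      1 * length (allVectors s) + 0
        ≡⟨ trans (ℕ.+-identityʳ _) (trans (ℕ.*-identityˡ _) (length-allVectors s)) ⟩
      q ^ s ∎
      where open ≡-Reasoning

    columnMatrix : ∀ {s} (cs : List (Fin s → Carrier)) → Fin s → Vect (length cs)
    columnMatrix cs l p = lookup cs p l

    wt-columnMatrix : ∀ {s} (cs : List (Fin s → Carrier)) a →
      wt (linComb a (columnMatrix cs)) ≡ countᴸ (λ v → nonzero? (dot a v)) cs
    wt-columnMatrix cs a = trans (wt-cong (λ p → ≈-reflexive (linComb≡dot a (columnMatrix cs) p))) (lookupWeight cs)
      where
      lookupWeight : ∀ cs → wt (λ p → dot a (lookup cs p)) ≡ countᴸ (λ v → nonzero? (dot a v)) cs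
      lookupWeight []       = refl
      lookupWeight (v ∷ cs) = cong (𝟙 (nonzero? (dot a v)) +_) (lookupWeight cs)

    simplexCode : ∀ s r → 1 ≤ r → HasCode (length (concat (replicate r (projectivePoints (suc s))))) (suc s) (r * q ^ s)
    simplexCode s r 1≤r = G , indep , (unit Fin.zero , 1≤wt⇒¬IsZeroVec (subst (1 ≤_) (sym wt-unit) 1≤rqˢ) , wt-unit) , minimal
      where
      columns = concat (replicate r (projectivePoints (suc s)))
      G = columnMatrix columns
      wt≡ : ∀ a → wt (linComb a G) ≡ r * countᴸ (λ v → nonzero? (dot a v)) (projectivePoints (suc s))
      wt≡ a = trans (wt-columnMatrix columns a) (countᴸ-concat-replicate _ r (projectivePoints (suc s)))
      1≤rqˢ : 1 ≤ r * q ^ s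
      1≤rqˢ = ℕ.*-mono-≤ 1≤r (ℕ.m^n>0 q s)
      wt-unit : wt (linComb (unit Fin.zero) G) ≡ r * q ^ s
      wt-unit = trans (wt≡ (unit Fin.zero)) (cong (r *_) (trans
        (countᴸ-cong (λ v → nonzero?-cong (dot-unit Fin.zero v)) (projectivePoints (suc s)))
        (projective-firstCoordinate s)))
      bound : ∀ a → ¬ (∀ l → a l ≈ 0#) → r * q ^ s ≤ wt (linComb a G)
      bound a a≉0 = subst (r * q ^ s ≤_) (sym (wt≡ a)) (ℕ.*-monoʳ-≤ r (projective-nonzeros s a a≉0))
      indep : LinIndep G
      indep a Ga≈0 with Finₚ.all? (λ l → a l ≟ 0#)
      ... | yes a≈0 = a≈0
      ... | no  a≉0 = ⊥-elim (1≤wt⇒¬IsZeroVec (ℕ.≤-trans 1≤rqˢ (bound a a≉0)) Ga≈0)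
      minimal : ∀ a → ¬ IsZeroVec (linComb a G) → r * q ^ s ≤ wt (linComb a G)
      minimal a Ga≉0 = bound a λ a≈0 → Ga≉0 λ p →
        ≈-trans (≈-reflexive (linComb≡dot a G p)) (dot-zeroˡ a (λ l → G l p) a≈0)

    IsS-simplex-bound : ∀ s r {x w} → 1 ≤ x → x ≤ r * q ^ s → IsS x (suc s) w → (q ∸ 1) * w ≤ r * (q ^ suc s ∸ 1)
    IsS-simplex-bound s zero     1≤x x≤0 _ = ⊥-elim (ℕ.<⇒≱ 1≤x x≤0)
    IsS-simplex-bound s r@(suc _) {x} {w} 1≤x x≤rqˢ isS = begin
      (q ∸ 1) * w                            ≤⟨ ℕ.*-monoʳ-≤ (q ∸ 1) w≤N ⟩
      (q ∸ 1) * N                            ≡⟨ cong ((q ∸ 1) *_) (length-concat-replicate r (projectivePoints (suc s))) ⟩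
      (q ∸ 1) * (r * length points)          ≡⟨ x∙yz≈y∙xz (q ∸ 1) r (length points) ⟩
      r * ((q ∸ 1) * length points)          ≡⟨ cong (r *_) (trans (sym (ℕ.m+n∸n≡m _ 1)) (cong (_∸ 1) (length-projectivePoints (suc s)))) ⟩
      r * (q ^ suc s ∸ 1)                    ∎
      where
      open ℕ.≤-Reasoning
      points = projectivePoints (suc s)
      N = length (concat (replicate r points))
      w≤N : w ≤ N
      w≤N = ℕ.+-cancelʳ-≤ (r * q ^ s) w N (ℕ.≤-trans (IsS-puncture-bound (simplexCode s r (s≤s z≤n)) 1≤x x≤rqˢ isS)
              (ℕ.+-monoʳ-≤ N x≤rqˢ))

  module BKZBasis {k n} (b : ℕ) (B : Fin (suc k) → Vect n) (reduced : BKZReduced (suc (suc b)) B) where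

    β : ℕ
    β = suc (suc b)

    covered : ℕ → Fin n → Bool
    covered j p = anyBelow j (λ l → nz (B l) p)

    ℓ : Fin (suc k) → ℕ
    ℓ i = wt (proj B (toℕ i) (B i))

    free : ℕ → ℕ
    free j = count (λ p → not (covered j p))

    proj-nz : ∀ j x p → nz (proj B j x) p ≡ true → covered j p ≡ false × nz x p ≡ true
    proj-nz j x p πx≢0 with covered j p
    ... | false = refl , πx≢0
    ... | true  with () ← nonzero?≡true⇒≉0 πx≢0 ≈-refl

    proj-uncovered : ∀ j x p → covered j p ≡ false → proj B j x p ≡ x p
    proj-uncovered j x p uncovered rewrite uncovered = refl

    pivot : ∀ i → Σ (Fin n) λ p → covered (toℕ i) p ≡ false × nz (B i) p ≡ true
    pivot i with p , πb≢0 ← support (proj₁ (reduced i)) = p , proj-nz (toℕ i) (B i) p πb≢0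

    earlierRows≈0 : ∀ (i : Fin (suc k)) p → covered (toℕ i) p ≡ false → ∀ r → toℕ r < toℕ i → B r p ≈ 0#
    earlierRows≈0 i p uncovered r r<i = nonzero?≡false⇒≈0 (anyBelow≡false⇒ (toℕ i) (λ l → nz (B l) p) uncovered r r<i)

    ℓ≤free : ∀ i → ℓ i ≤ free (toℕ i)
    ℓ≤free i = subst (_≤ free (toℕ i)) (sym (wt≡count (proj B (toℕ i) (B i)))) (sum-mono-≤ pointwise)
      where
      pointwise : ∀ p → 𝟙 (nz (proj B (toℕ i) (B i)) p) ≤ 𝟙 (not (covered (toℕ i) p))
      pointwise p with nz (proj B (toℕ i) (B i)) p in πb?
      ... | false = z≤n
      ... | true rewrite proj₁ (proj-nz (toℕ i) (B i) p πb?) = ℕ.≤-refl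

    blockRow : ∀ (i : Fin (suc k)) {r} → toℕ i + r ≤ suc k → Fin r → Fin (suc k)
    blockRow i fit l = Fin.fromℕ< (ℕ.≤-trans (ℕ.+-monoʳ-< (toℕ i) (Finₚ.toℕ<n l)) fit)

    toℕ-blockRow : ∀ (i : Fin (suc k)) {r} (fit : toℕ i + r ≤ suc k) l → toℕ (blockRow i fit l) ≡ toℕ i + toℕ l
    toℕ-blockRow i fit l = Finₚ.toℕ-fromℕ< _

    blockRow-zero : ∀ (i : Fin (suc k)) {r} (fit : toℕ i + suc r ≤ suc k) → blockRow i fit Fin.zero ≡ i
    blockRow-zero i fit = Finₚ.toℕ-injective (trans (toℕ-blockRow i fit Fin.zero) (ℕ.+-identityʳ (toℕ i)))

    blockCombination : ∀ (i : Fin (suc k)) {r} → toℕ i + r ≤ suc k → (Fin r → Carrier) → Vect n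
    blockCombination i fit a′ p = dot a′ (λ l → proj B (toℕ i) (B (blockRow i fit l)) p)

    ℓ-minimal : ∀ i {r} → r ≤ β → (fit : toℕ i + r ≤ suc k) (a′ : Fin r → Carrier) →
      ¬ IsZeroVec (blockCombination i fit a′) → ℓ i ≤ wt (blockCombination i fit a′)
    ℓ-minimal i {r} r≤β fit a′ nonzero =
      subst (ℓ i ≤_) (wt-cong spread≈) (proj₂ (reduced i) a inBlock
        (λ isZero → nonzero (λ p → ≈-trans (≈-sym (spread≈ p)) (isZero p))))
      where
      rows : Fin (suc k) → Vect n
      rows t = proj B (toℕ i) (B t)
      a : Fin (suc k) → Carrier
      a t = dot a′ (λ l → unit (blockRow i fit l) t)
      inBlock : ∀ t → ¬ (toℕ i ≤ toℕ t × toℕ t < toℕ i + β) → a t ≈ 0#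
      inBlock t outside = dot-zeroʳ a′ _ λ l → unit-≢ λ row≡t → outside (subst (λ u → toℕ i ≤ u × u < toℕ i + β)
        (trans (sym (toℕ-blockRow i fit l)) (cong toℕ row≡t))
        (ℕ.m≤m+n (toℕ i) (toℕ l) , ℕ.+-monoʳ-< (toℕ i) (ℕ.<-≤-trans (Finₚ.toℕ<n l) r≤β)))
      spread≈ : ∀ p → linComb a rows p ≈ blockCombination i fit a′ p
      spread≈ p = begin
        linComb a rows p                                          ≡⟨ linComb≡dot a rows p ⟩
        dot a (λ t → rows t p)                                    ≈⟨ dot-assoc a′ (λ l → unit (blockRow i fit l)) (λ t → rows t p) ⟩
        dot a′ (λ l → dot (unit (blockRow i fit l)) (λ t → rows t p)) ≈⟨ dot-cong (λ l → ≈-refl) (λ l → dot-unit (blockRow i fit l) (λ t → rows t p)) ⟩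
        blockCombination i fit a′ p                               ∎
        where open ≈-Reasoning

    pencil : Fin (suc k) → Fin (suc k) → Carrier → Vect n
    pencil i i′ α p = α ⊛ proj B (toℕ i) (B i) p ⊕ proj B (toℕ i) (B i′) p

    ℓ≤wt-pencil : ∀ i i′ → toℕ i′ ≡ suc (toℕ i) → ∀ α → ℓ i ≤ wt (pencil i i′ α)
    ℓ≤wt-pencil i i′ i′≡1+i α = subst (ℓ i ≤_) (wt-cong pencil≈) (ℓ-minimal i (s≤s (s≤s z≤n)) fit (α V.∷ (1# V.∷ V.[]))
      (λ isZero → pencil≉0 (λ p → ≈-trans (≈-sym (pencil≈ p)) (isZero p))))
      where
      i<i′ : toℕ i < toℕ i′
      i<i′ = ℕ.≤-reflexive (sym i′≡1+i)
      fit : toℕ i + 2 ≤ suc k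
      fit = subst (_≤ suc k) (trans (cong suc i′≡1+i) (ℕ.+-comm 2 (toℕ i))) (Finₚ.toℕ<n i′)
      secondRow : blockRow i fit (Fin.suc Fin.zero) ≡ i′
      secondRow = Finₚ.toℕ-injective (trans (toℕ-blockRow i fit _) (trans (ℕ.+-comm (toℕ i) 1) (sym i′≡1+i)))
      pencil≈ : ∀ p → blockCombination i fit (α V.∷ (1# V.∷ V.[])) p ≈ pencil i i′ α p
      pencil≈ p = +-cong (*-congˡ (≈-reflexive (cong (λ t → proj B (toℕ i) (B t) p) (blockRow-zero i fit))))
        (≈-trans (+-identityʳ _) (≈-trans (*-identityˡ _) (≈-reflexive (cong (λ t → proj B (toℕ i) (B t) p) secondRow))))
      pencil≉0 : ¬ IsZeroVec (pencil i i′ α)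
      pencil≉0 isZero with p , uncoveredᵢ′ , b′≢0 ← pivot i′ = nonzero?≡true⇒≉0 b′≢0 (begin
          B i′ p                                  ≡⟨ proj-uncovered (toℕ i) (B i′) p uncoveredᵢ ⟨
          proj B (toℕ i) (B i′) p                 ≈⟨ +-identityˡ _ ⟨
          0# ⊕ proj B (toℕ i) (B i′) p            ≈⟨ +-congʳ (≈-trans (*-congˡ bᵢ≈0) (zeroʳ α)) ⟨
          pencil i i′ α p                         ≈⟨ isZero p ⟩
          0#                                      ∎)
        where
        open ≈-Reasoning
        uncoveredᵢ : covered (toℕ i) p ≡ false
        uncoveredᵢ = anyBelow-mono (λ t → nz (B t) p) (ℕ.<⇒≤ i<i′) uncoveredᵢ′
        bᵢ≈0 : proj B (toℕ i) (B i) p ≈ 0#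
        bᵢ≈0 = ≈-trans (≈-reflexive (proj-uncovered (toℕ i) (B i) p uncoveredᵢ)) (earlierRows≈0 i′ p uncoveredᵢ′ i i<i′)

    pencil-support : ∀ i i′ → toℕ i′ ≡ suc (toℕ i) → ∀ p → proj B (toℕ i) (B i) p ≈ 0# →
      ¬ proj B (toℕ i) (B i′) p ≈ 0# → ¬ proj B (toℕ i′) (B i′) p ≈ 0#
    pencil-support i i′ i′≡1+i p bᵢ≈0 b≉0 with uncoveredᵢ , b′≢0 ← proj-nz (toℕ i) (B i′) p (≉0⇒nonzero?≡true b≉0) =
      subst (λ u → ¬ u ≈ 0#) (sym (proj-uncovered (toℕ i′) (B i′) p uncoveredᵢ′)) (nonzero?≡true⇒≉0 b′≢0)
      where
      uncoveredᵢ′ : covered (toℕ i′) p ≡ false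
      uncoveredᵢ′ = subst (λ t → covered t p ≡ false) (sym i′≡1+i)
        (anyBelow-extend (toℕ i) (λ t → nz (B t) p) i refl uncoveredᵢ
          (≈0⇒nonzero?≡false (≈-trans (≈-sym (≈-reflexive (proj-uncovered (toℕ i) (B i) p uncoveredᵢ))) bᵢ≈0)))

    module Block (i : Fin (suc k)) (fit : toℕ i + β ≤ suc k) where
      G : Fin β → Vect n
      G l = proj B (toℕ i) (B (blockRow i fit l))

      linComb≡blockCombination : ∀ a p → linComb a G p ≡ blockCombination i fit a p
      linComb≡blockCombination a p = linComb≡dot a G p

      i≤blockRow : ∀ l → toℕ i ≤ toℕ (blockRow i fit l)
      i≤blockRow l = subst (toℕ i ≤_) (sym (toℕ-blockRow i fit l)) (ℕ.m≤m+n (toℕ i) (toℕ l))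

      staircase : ∀ l → Σ (Fin n) λ p → ¬ G l p ≈ 0# × (∀ l′ → toℕ l′ < toℕ l → G l′ p ≈ 0#)
      staircase l with p , uncovered , b≢0 ← pivot (blockRow i fit l) = p , Gl≉0 , earlier≈0
        where
        uncoveredᵢ : covered (toℕ i) p ≡ false
        uncoveredᵢ = anyBelow-mono (λ t → nz (B t) p) (i≤blockRow l) uncovered
        Gl≉0 : ¬ G l p ≈ 0#
        Gl≉0 = subst (λ u → ¬ u ≈ 0#) (sym (proj-uncovered (toℕ i) (B (blockRow i fit l)) p uncoveredᵢ)) (nonzero?≡true⇒≉0 b≢0)
        earlier≈0 : ∀ l′ → toℕ l′ < toℕ l → G l′ p ≈ 0#
        earlier≈0 l′ l′<l = ≈-trans (≈-reflexive (proj-uncovered (toℕ i) (B (blockRow i fit l′)) p uncoveredᵢ))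
          (earlierRows≈0 (blockRow i fit l) p uncovered (blockRow i fit l′)
            (subst₂ _<_ (sym (toℕ-blockRow i fit l′)) (sym (toℕ-blockRow i fit l)) (ℕ.+-monoʳ-< (toℕ i) l′<l)))

      generates : GeneratesCode G (ℓ i)
      generates = staircase⇒LinIndep G staircase ,
        (unit Fin.zero , (λ isZero → proj₁ (reduced i) (λ p → ≈-trans (≈-sym (first≈ p)) (isZero p))) ,
         wt-cong first≈) ,
        λ a nonzero → subst (ℓ i ≤_) (sym (wt-cong (≈-reflexive ∘ linComb≡blockCombination a)))
          (ℓ-minimal i ℕ.≤-refl fit a (λ isZero → nonzero (λ p →
            ≈-trans (≈-reflexive (linComb≡blockCombination a p)) (isZero p))))
        where
        first≈ : ∀ p → linComb (unit Fin.zero) G p ≈ proj B (toℕ i) (B i) p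
        first≈ p = ≈-trans (≈-reflexive (linComb≡dot (unit Fin.zero) G p))
          (≈-trans (dot-unit Fin.zero (λ l → G l p)) (≈-reflexive (cong (λ t → proj B (toℕ i) (B t) p) (blockRow-zero i fit))))

      blockCode : HasCode (count (nonzeroColumn G)) β (ℓ i)
      blockCode with G′ , wt≡ ← dropZeroColumns G = G′ , GeneratesCode-transport {G = G} {G′} wt≡ generates

      nonzeroColumn⇒uncovered : ∀ p → nonzeroColumn G p ≡ true →
        Σ (Fin β) λ l → covered (toℕ i) p ≡ false × nz (B (blockRow i fit l)) p ≡ true
      nonzeroColumn⇒uncovered p nonzeroCol with l , _ , Gl≢0 ← anyBelow≡true⇒∃ β (λ l → nz (G l) p) nonzeroCol =
        l , proj-nz (toℕ i) (B (blockRow i fit l)) p Gl≢0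

      nonzeroColumns≤free : count (nonzeroColumn G) ≤ free (toℕ i)
      nonzeroColumns≤free = sum-mono-≤ pointwise
        where
        pointwise : ∀ p → 𝟙 (nonzeroColumn G p) ≤ 𝟙 (not (covered (toℕ i) p))
        pointwise p with nonzeroColumn G p in nonzeroCol
        ... | false = z≤n
        ... | true rewrite proj₁ (proj₂ (nonzeroColumn⇒uncovered p nonzeroCol)) = ℕ.≤-refl

      nonzeroColumns+free≤free+ℓ : ∀ j → toℕ j ≡ toℕ i + suc b →
        count (nonzeroColumn G) + free (toℕ j) ≤ free (toℕ i) + ℓ j
      nonzeroColumns+free≤free+ℓ j j≡last = subst (count (nonzeroColumn G) + free (toℕ j) ≤_)
        (cong (free (toℕ i) +_) (sym (wt≡count (proj B (toℕ j) (B j)))))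
        (count-+-mono-≤ (nonzeroColumn G) (λ p → not (covered (toℕ j) p))
                        (λ p → not (covered (toℕ i) p)) (nz (proj B (toℕ j) (B j))) pointwise)
        where
        pointwise : ∀ p → 𝟙 (nonzeroColumn G p) + 𝟙 (not (covered (toℕ j) p))
                          ≤ 𝟙 (not (covered (toℕ i) p)) + 𝟙 (nz (proj B (toℕ j) (B j)) p)
        pointwise p with covered (toℕ j) p in coveredⱼ | nonzeroColumn G p in nonzeroCol
        ... | true  | false = z≤n
        ... | true  | true
          rewrite proj₁ (proj₂ (nonzeroColumn⇒uncovered p nonzeroCol)) = s≤s z≤n
        ... | false | false
          rewrite anyBelow-mono (λ t → nz (B t) p) (subst (toℕ i ≤_) (sym j≡last) (ℕ.m≤m+n _ _)) coveredⱼ = s≤s z≤n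
        ... | false | true with nonzeroColumn⇒uncovered p nonzeroCol
        ...   | l , uncoveredᵢ , b≢0 with ℕ.<-cmp (toℕ (blockRow i fit l)) (toℕ j)
        ...     | tri< row<j _ _ with () ← trans (sym (anyBelow-intro (toℕ j) (λ t → nz (B t) p) _ row<j b≢0)) coveredⱼ
        ...     | tri≈ _ row≡j _
          rewrite uncoveredᵢ
                | subst (λ t → nz (B t) p ≡ true) (Finₚ.toℕ-injective row≡j) b≢0 = ℕ.≤-refl
        ...     | tri> _ _ row>j = ⊥-elim (ℕ.<⇒≱ row>j (subst₂ _≤_ (sym (toℕ-blockRow i fit l)) (sym j≡last)
                    (ℕ.+-monoʳ-≤ (toℕ i) (ℕ.≤-pred (Finₚ.toℕ<n l)))))

    blockFits : ∀ (i : Fin (suc k)) u → toℕ i + suc u * suc b ≡ k → toℕ i + β ≤ suc k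
    blockFits i u i+u+1≡k = subst (_≤ suc k) (sym (ℕ.+-suc (toℕ i) (suc b)))
      (s≤s (subst (toℕ i + suc b ≤_) i+u+1≡k (ℕ.+-monoʳ-≤ (toℕ i) (ℕ.m≤m+n (suc b) (u * suc b)))))

    blockBounds : ∀ (i : Fin (suc k)) → toℕ i + β ≤ suc k → ∀ {x s} → 1 ≤ x → x ≤ ℓ i → IsS x β s →
      Σ ℕ λ N → s + ℓ i ≤ N + x × N ≤ free (toℕ i)
              × (∀ j → toℕ j ≡ toℕ i + suc b → N + free (toℕ j) ≤ free (toℕ i) + ℓ j)
    blockBounds i fit 1≤x x≤ℓ isS =
      count (nonzeroColumn G) , IsS-puncture-bound blockCode 1≤x x≤ℓ isS , nonzeroColumns≤free , nonzeroColumns+free≤free+ℓ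
      where open Block i fit

  module Telescope {k n} (b : ℕ) (B : Fin (suc k) → Vect n) (reduced : BKZReduced (suc (suc b)) B) (q : ℕ)
    (enumeration : Bijection ≈-setoid (setoid (Fin q))) where
    open BKZBasis b B reduced
    open FiniteField q enumeration

    ℓ≤q*ℓ-next : ∀ i i′ → toℕ i′ ≡ suc (toℕ i) → ℓ i ≤ q * ℓ i′
    ℓ≤q*ℓ-next i i′ i′≡1+i = ℕ.+-cancelˡ-≤ (q * ℓ i) (ℓ i) (q * ℓ i′) (begin
      q * ℓ i + ℓ i                                  ≡⟨ cong (_+ ℓ i) (sum-const q (ℓ i)) ⟨
      sum {q} (λ _ → ℓ i) + ℓ i                      ≤⟨ ℕ.+-monoˡ-≤ (ℓ i) (sum-mono-≤ (ℓ≤wt-pencil i i′ i′≡1+i ∘ element)) ⟩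
      sum (λ j → wt (pencil i i′ (element j))) + ℓ i ≤⟨ pencil-weight _ _ _ (pencil-support i i′ i′≡1+i) ⟩
      q * ℓ i + q * ℓ i′                             ∎)
      where open ℕ.≤-Reasoning

    ℓ≤q^s*ℓ : ∀ s i i′ → toℕ i′ ≡ s + toℕ i → ℓ i ≤ q ^ s * ℓ i′
    ℓ≤q^s*ℓ zero    i i′ i′≡i rewrite Finₚ.toℕ-injective {i = i′} {j = i} i′≡i = ℕ.≤-reflexive (sym (ℕ.+-identityʳ (ℓ i)))
    ℓ≤q^s*ℓ (suc s) i i′ i′≡1+s+i = begin
      ℓ i                  ≤⟨ ℓ≤q^s*ℓ s i i″ (Finₚ.toℕ-fromℕ< i″<1+k) ⟩
      q ^ s * ℓ i″         ≤⟨ ℕ.*-monoʳ-≤ (q ^ s) (ℓ≤q*ℓ-next i″ i′ (trans i′≡1+s+i (cong suc (sym (Finₚ.toℕ-fromℕ< i″<1+k))))) ⟩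
      q ^ s * (q * ℓ i′)   ≡⟨ x∙yz≈y∙xz (q ^ s) q (ℓ i′) ⟩
      q * (q ^ s * ℓ i′)   ≡⟨ ℕ.*-assoc q (q ^ s) (ℓ i′) ⟨
      q ^ suc s * ℓ i′     ∎
      where
      open ℕ.≤-Reasoning
      i″<1+k : s + toℕ i < suc k
      i″<1+k = ℕ.<-trans (subst (s + toℕ i <_) (sym i′≡1+s+i) (ℕ.n<1+n _)) (Finₚ.toℕ<n i′)
      i″ = Fin.fromℕ< i″<1+k

    ⌈⌉≤self : ∀ w → ⌈ (q ∸ 1) * w / (q ^ β ∸ 1) ⌉ ≤ w
    ⌈⌉≤self w = ⌈/⌉≤ _ _ w (subst ((q ∸ 1) * w ≤_) (ℕ.*-comm (q ^ β ∸ 1) w) (ℕ.*-monoˡ-≤ w (ℕ.∸-monoˡ-≤ 1 q≤q^β)))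
      where
      q≤q^β : q ≤ q ^ β
      q≤q^β = subst (_≤ q ^ β) (ℕ.*-identityʳ q) (ℕ.*-monoʳ-≤ q (ℕ.m^n>0 q (suc b)))

    ⌈⌉≤ℓ-blockEnd : ∀ i j → toℕ j ≡ toℕ i + suc b → ∀ {x w} → IsS x β w → x ≤ ℓ i →
      ⌈ (q ∸ 1) * w / (q ^ β ∸ 1) ⌉ ≤ ℓ j
    ⌈⌉≤ℓ-blockEnd i j toℕ-j isS x≤ℓ = ⌈/⌉≤ _ _ (ℓ j) (IsS-simplex-bound (suc b) (ℓ j) (IsS⇒1≤d isS)
      (ℕ.≤-trans x≤ℓ (subst (ℓ i ≤_) (ℕ.*-comm (q ^ suc b) (ℓ j))
        (ℓ≤q^s*ℓ (suc b) i j (trans toℕ-j (ℕ.+-comm (toℕ i) (suc b))))))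
      isS)

    AlternatingBound : ℕ → Set (c ⊔ ℓ′)
    AlternatingBound u = ∀ i → toℕ i + u * suc b ≡ k → ∀ x (w c : ℕ → ℕ) → IsS x β (w 1) → x ≤ ℓ i →
      (∀ t → 1 ≤ t → c t ≡ ⌈ (q ∸ 1) * w t / (q ^ β ∸ 1) ⌉) → (∀ t → 1 ≤ t → IsS (c t) β (w (suc t))) →
      altSum w c u + ℓ i ≤ free (toℕ i) + x

    alternatingBound : ∀ u → AlternatingBound u
    alternatingBound zero i _ x w c _ _ _ _ = ℕ.≤-trans (ℓ≤free i) (ℕ.m≤m+n _ x)
    alternatingBound (suc zero) i i+1≡k x w c isS x≤ℓ _ _ =
      let N , firstBlock , N≤free , _ = blockBounds i (blockFits i 0 i+1≡k) (IsS⇒1≤d isS) x≤ℓ isS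
      in ℕ.≤-trans firstBlock (ℕ.+-monoˡ-≤ x N≤free)
    alternatingBound (suc (suc u)) i i+u+2≡k x w c isS x≤ℓ c≡ isSᶜ =
      let N , firstBlock , _ , columns = blockBounds i (blockFits i (suc u) i+u+2≡k) (IsS⇒1≤d isS) x≤ℓ isS
      in subst (λ t → t + ℓ i ≤ free (toℕ i) + x) (sym (altSum-shift w c u))
        (alternating-step (subst (_≤ w 1) (sym (c≡ 1 ℕ.≤-refl)) (⌈⌉≤self (w 1))) firstBlock (columns j toℕ-j)
          (alternatingBound (suc u) j j+u+1≡k (c 1) (w ∘ suc) (c ∘ suc) (isSᶜ 1 ℕ.≤-refl) c₁≤ℓⱼ
            (λ t _ → c≡ (suc t) (s≤s z≤n)) (λ t _ → isSᶜ (suc t) (s≤s z≤n))))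
      where
      j<1+k : toℕ i + suc b < suc k
      j<1+k = s≤s (subst (toℕ i + suc b ≤_) i+u+2≡k (ℕ.+-monoʳ-≤ (toℕ i) (ℕ.m≤m+n (suc b) _)))
      j = Fin.fromℕ< j<1+k
      toℕ-j : toℕ j ≡ toℕ i + suc b
      toℕ-j = Finₚ.toℕ-fromℕ< j<1+k
      j+u+1≡k : toℕ j + suc u * suc b ≡ k
      j+u+1≡k = trans (cong (_+ suc u * suc b) toℕ-j) (trans (ℕ.+-assoc (toℕ i) (suc b) _) i+u+2≡k)
      c₁≤ℓⱼ : c 1 ≤ ℓ j
      c₁≤ℓⱼ = subst (_≤ ℓ j) (sym (c≡ 1 ℕ.≤-refl)) (⌈⌉≤ℓ-blockEnd i j toℕ-j isS x≤ℓ)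

mainTheorem5 : ∀ {c ℓ : Level} (R : CommutativeRing c ℓ) → IsField R
    → (_≟_ : Decidable (CommutativeRing._≈_ R))
    → (q : ℕ) → Bijection (CommutativeRing.setoid R) (setoid (Fin q))
    → Σ ℕ (λ p → Σ ℕ (λ e → Prime p × q ≡ p ^ suc e))
    → (k n β : ℕ) → 2 ≤ β
    → (B : Fin (suc k) → Coding.Vect R _≟_ n)
    → Coding.LinIndep R _≟_ B
    → Coding.BKZReduced R _≟_ β B
    → (m : ℕ) → k ≡ m * (β ∸ 1)
    → (w c : ℕ → ℕ)
    → Coding.IsS R _≟_ (Coding.wt R _≟_ (B Fin.zero)) β (w 1)
    → (∀ i → 1 ≤ i → c i ≡ ⌈ (q ∸ 1) * w i / (q ^ β ∸ 1) ⌉)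
    → (∀ i → 1 ≤ i → Coding.IsS R _≟_ (c i) β (w (suc i)))
    → altSum w c m ≤ n
mainTheorem5 R isField _≟_ q enumeration _ k n .(suc (suc b)) (s≤s (s≤s (z≤n {b}))) B _ reduced m k≡m*[β-1] w c
             isS c≡ isSᶜ =
  ℕ.+-cancelʳ-≤ ℓ₀ (altSum w c m) n (subst (λ f → altSum w c m + ℓ₀ ≤ f + ℓ₀) (count-true n)
    (alternatingBound m Fin.zero (sym k≡m*[β-1]) ℓ₀ w c isS ℕ.≤-refl c≡ isSᶜ))
  where
  open OverField R isField _≟_
  open Telescope b B reduced q enumeration
  ℓ₀ = Coding.wt R _≟_ (B Fin.zero)
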